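{- Let $k\ge2$, $1\le r\le k-1$, $1\le s\le k-r$, and $n\ge0$ be integers. Then the number of compositions of $n+s$ with exactly one part congruent to $r+s$ modulo $k$ and every other part congruent to $r$ modulo $k$ equals the total number of parts in all compositions of $n$ whose parts are all congruent to $r$ modulo $k$.
   Context: A composition of $n$ is a finite sequence of positive integers summing to $n$; its entries are its parts. The empty sequence is the unique composition of $0$ and has no parts. -}

module Defs where

open import Data.Nat using (ℕ; zero; suc; _+_; _∸_; _%_; _≟_; NonZero)
open import Data.Nat.ListAction using (sum)
open import Data.List using (List; []; _∷_; map; concatMap; length; filter; upTo)
open import Data.List.Relation.Unary.All using (All)
open import Data.List.Relation.Unary.All.Properties using ()
import Data.List.Relation.Unary.All as All
open import Data.Product using (_×_)
open import Relation.Nullary.Decidable using (_×-dec_)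
open import Relation.Unary using (Decidable)
open import Relation.Binary.PropositionalEquality using (_≡_)

-- The fuel argument only makes the
-- recursion structural; with fuel = n the enumeration is exact (each composition once).
compsFuel : ℕ → ℕ → List (List ℕ)
compsFuel _ zero = [] ∷ []
compsFuel zero (suc _) = []
compsFuel (suc f) (suc m) =
  concatMap (λ i → map (suc i ∷_) (compsFuel f (m ∸ i))) (upTo (suc m))

compositions : ℕ → List (List ℕ)
compositions n = compsFuel n n

partsCong : (k : ℕ) → .{{NonZero k}} → ℕ → List ℕ → List ℕ
partsCong k a = filter (λ p → p % k ≟ a % k)

OneSpecial : (k r s : ℕ) → .{{NonZero k}} → List ℕ → Set
OneSpecial k r s ps =
  length (partsCong k (r + s) ps) ≡ 1 ×
  length (partsCong k (r + s) ps) + length (partsCong k r ps) ≡ length ps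

oneSpecial? : (k r s : ℕ) → .{{_ : NonZero k}} → Decidable (OneSpecial k r s)
oneSpecial? k r s ps =
  (length (partsCong k (r + s) ps) ≟ 1) ×-dec
  (length (partsCong k (r + s) ps) + length (partsCong k r ps) ≟ length ps)

AllCong : (k r : ℕ) → .{{NonZero k}} → List ℕ → Set
AllCong k r = All (λ p → p % k ≡ r % k)

allCong? : (k r : ℕ) → .{{_ : NonZero k}} → Decidable (AllCong k r)
allCong? k r = All.all? (λ p → p % k ≟ r % k)

module Submission where

-- Write f p and g p for the indicators of "p ≡ r (mod k)" and
-- "p ≡ r + s (mod k)", and let
--   A N = number of compositions of N with all parts ≡ r,
--   T N = total number of parts of those compositions,
--   B N = number of compositions of N with one part ≡ r + s, the others ≡ r.
-- Splitting off the first part p of a composition gives the recurrences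
--   T N = Σ_{1 ≤ p ≤ N} (f p · T (N - p) + f p · A (N - p)),
--   B N = Σ_{1 ≤ p ≤ N} (f p · B (N - p) + g p · A (N - p)),
-- the second one using only that the residues r and r + s are distinct.  When
-- 1 ≤ r, 1 ≤ s and r + s ≤ k, no part p ≤ s is ≡ r + s and g (p + s) = f p;
-- hence B j = 0 for j < s, and by strong induction B (n + s) = T n, which is
-- the theorem once the two counts are rewritten as weighted sums.

open import Defs
open import Data.Nat using (ℕ; zero; suc; _+_; _*_; _∸_; _%_; _≤_; _<_; NonZero; >-nonZero; s≤s; z≤n)
open import Data.Nat.Properties
open import Data.Nat.DivMod using (%-distribˡ-+; [m+n]%n≡m%n; m<n⇒m%n≡m; n%n≡0)
open import Data.Nat.Induction using (<-rec)
open import Data.Nat.ListAction using (sum)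
open import Data.List using (List; []; _∷_; _++_; length; filter; map; concatMap; upTo; applyUpTo)
open import Data.List.Properties
  using (map-∘; map-cong; map-upTo; concatMap-cong;
         filter-accept; filter-reject; filter-all; filter-none; filter-complete)
open import Data.List.Relation.Unary.All using (_∷_)
import Data.List.Relation.Unary.All as All
open import Data.List.Relation.Unary.All.Properties using (all-filter)
open import Algebra.Properties.CommutativeSemigroup +-commutativeSemigroup using (interchange)
open import Data.Bool using (true; false)
open import Data.Product using (_×_; _,_; map₂)
open import Data.Sum using (inj₁; inj₂)
open import Data.Empty using (⊥-elim)
open import Function using (_∘_)
open import Level using (Level)
open import Function.Bundles using (_⇔_; mk⇔; Equivalence)
open import Relation.Nullary using (Dec; yes; no; ¬_; _because_)
open import Relation.Nullary.Decidable using (_×-dec_)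
open import Relation.Unary using (Pred; Decidable)
open import Relation.Binary.PropositionalEquality
  using (_≡_; _≢_; refl; sym; trans; cong; cong₂; subst; module ≡-Reasoning)

indicator : ∀ {p} {P : Set p} → Dec P → ℕ
indicator (true because _) = 1
indicator (false because _) = 0

indicator-⇔ : ∀ {p q} {P : Set p} {Q : Set q} → P ⇔ Q → (a : Dec P) (b : Dec Q) →
  indicator a ≡ indicator b
indicator-⇔ P⇔Q (yes _) (yes _) = refl
indicator-⇔ P⇔Q (yes p) (no ¬q) = ⊥-elim (¬q (Equivalence.to P⇔Q p))
indicator-⇔ P⇔Q (no ¬p) (yes q) = ⊥-elim (¬p (Equivalence.from P⇔Q q))
indicator-⇔ P⇔Q (no _) (no _) = refl

indicator-× : ∀ {p q} {P : Set p} {Q : Set q} (a : Dec P) (b : Dec Q) →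
  indicator (a ×-dec b) ≡ indicator a * indicator b
indicator-× (yes _) (yes _) = refl
indicator-× (yes _) (no _) = refl
indicator-× (no _) (yes _) = refl
indicator-× (no _) (no _) = refl

indicator-¬ : ∀ {p} {P : Set p} → ¬ P → (a : Dec P) → indicator a ≡ 0
indicator-¬ ¬p (yes p) = ⊥-elim (¬p p)
indicator-¬ ¬p (no _) = refl

Σ< : ℕ → (ℕ → ℕ) → ℕ
Σ< n h = sum (applyUpTo h n)

Σ<-split : ∀ a b h → Σ< (a + b) h ≡ Σ< a h + Σ< b (λ i → h (a + i))
Σ<-split zero b h = refl
Σ<-split (suc a) b h = trans (cong (h 0 +_) (Σ<-split a b (h ∘ suc))) (sym (+-assoc (h 0) _ _))

Σ<-cong : ∀ n {h h'} → (∀ i → i < n → h i ≡ h' i) → Σ< n h ≡ Σ< n h'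
Σ<-cong zero e = refl
Σ<-cong (suc n) e = cong₂ _+_ (e 0 (s≤s z≤n)) (Σ<-cong n (λ i i<n → e (suc i) (s≤s i<n)))

Σ<-zero : ∀ n {h} → (∀ i → i < n → h i ≡ 0) → Σ< n h ≡ 0
Σ<-zero zero e = refl
Σ<-zero (suc n) {h} e =
  trans (cong (_+ Σ< n (h ∘ suc)) (e 0 (s≤s z≤n))) (Σ<-zero n (λ i i<n → e (suc i) (s≤s i<n)))

Σ<-+ : ∀ n h h' → Σ< n (λ i → h i + h' i) ≡ Σ< n h + Σ< n h'
Σ<-+ zero h h' = refl
Σ<-+ (suc n) h h' =
  trans (cong (h 0 + h' 0 +_) (Σ<-+ n (h ∘ suc) (h' ∘ suc))) (interchange (h 0) (h' 0) _ _)

private variable X Y : Set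

sum-map-++ : (w : X → ℕ) (xs ys : List X) →
  sum (map w (xs ++ ys)) ≡ sum (map w xs) + sum (map w ys)
sum-map-++ w [] ys = refl
sum-map-++ w (x ∷ xs) ys = trans (cong (w x +_) (sum-map-++ w xs ys)) (sym (+-assoc (w x) _ _))

sum-map-concatMap : (w : Y → ℕ) (h : X → List Y) (xs : List X) →
  sum (map w (concatMap h xs)) ≡ sum (map (λ x → sum (map w (h x))) xs)
sum-map-concatMap w h [] = refl
sum-map-concatMap w h (x ∷ xs) =
  trans (sum-map-++ w (h x) (concatMap h xs)) (cong (sum (map w (h x)) +_) (sum-map-concatMap w h xs))

sum-map-* : (c : ℕ) (w : X → ℕ) (xs : List X) → sum (map (λ x → c * w x) xs) ≡ c * sum (map w xs)
sum-map-* c w [] = sym (*-zeroʳ c)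
sum-map-* c w (x ∷ xs) = trans (cong (c * w x +_) (sum-map-* c w xs)) (sym (*-distribˡ-+ c (w x) _))

sum-map-+ : (w w' : X → ℕ) (xs : List X) →
  sum (map (λ x → w x + w' x) xs) ≡ sum (map w xs) + sum (map w' xs)
sum-map-+ w w' [] = refl
sum-map-+ w w' (x ∷ xs) =
  trans (cong (w x + w' x +_) (sum-map-+ w w' xs)) (interchange (w x) (w' x) _ _)

length-filter-indicator : {ℓ : Level} {P : Pred X ℓ} (P? : Decidable P) (xs : List X) →
  length (filter P? xs) ≡ sum (map (indicator ∘ P?) xs)
length-filter-indicator P? [] = refl
length-filter-indicator P? (x ∷ xs) with P? x
... | yes _ = cong suc (length-filter-indicator P? xs)
... | no _ = length-filter-indicator P? xs

sum-map-filter : {ℓ : Level} {P : Pred X ℓ} (P? : Decidable P) (h : X → ℕ) (xs : List X) →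
  sum (map h (filter P? xs)) ≡ sum (map (λ x → indicator (P? x) * h x) xs)
sum-map-filter P? h [] = refl
sum-map-filter P? h (x ∷ xs) with P? x
... | yes _ = cong₂ _+_ (sym (+-identityʳ (h x))) (sum-map-filter P? h xs)
... | no _ = sum-map-filter P? h xs

compsFuel-stable : ∀ f g m → m ≤ f → m ≤ g → compsFuel f m ≡ compsFuel g m
compsFuel-stable f g zero _ _ = refl
compsFuel-stable (suc f) (suc g) (suc m) (s≤s m≤f) (s≤s m≤g) = concatMap-cong rest (upTo (suc m))
  where
  rest : ∀ i → map (suc i ∷_) (compsFuel f (m ∸ i)) ≡ map (suc i ∷_) (compsFuel g (m ∸ i))
  rest i = cong (map (suc i ∷_))
    (compsFuel-stable f g (m ∸ i) (≤-trans (m∸n≤m m i) m≤f) (≤-trans (m∸n≤m m i) m≤g))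

Σcomp : (List ℕ → ℕ) → ℕ → ℕ
Σcomp w N = sum (map w (compositions N))

Σcomp-suc : ∀ w m → Σcomp w (suc m) ≡ Σ< (suc m) (λ i → Σcomp (w ∘ (suc i ∷_)) (m ∸ i))
Σcomp-suc w m = begin
  sum (map w (concatMap block (upTo (suc m))))        ≡⟨ sum-map-concatMap w block (upTo (suc m)) ⟩
  sum (map (λ i → sum (map w (block i))) (upTo (suc m))) ≡⟨ cong sum (map-upTo _ (suc m)) ⟩
  Σ< (suc m) (λ i → sum (map w (block i)))            ≡⟨ Σ<-cong (suc m) (λ i _ → block-weight i) ⟩
  Σ< (suc m) (λ i → Σcomp (w ∘ (suc i ∷_)) (m ∸ i))   ∎
  where
  open ≡-Reasoning
  block : ℕ → List (List ℕ)
  block i = map (suc i ∷_) (compsFuel m (m ∸ i))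
  block-weight : ∀ i → sum (map w (block i)) ≡ Σcomp (w ∘ (suc i ∷_)) (m ∸ i)
  block-weight i = trans (cong sum (sym (map-∘ (compsFuel m (m ∸ i)))))
    (cong (sum ∘ map (w ∘ (suc i ∷_))) (compsFuel-stable m (m ∸ i) (m ∸ i) (m∸n≤m m i) ≤-refl))

Σcomp-rec : (w w₁ w₂ : List ℕ → ℕ) (c d : ℕ → ℕ) → w [] ≡ 0 →
  (∀ p ps → w (p ∷ ps) ≡ c p * w₁ ps + d p * w₂ ps) →
  ∀ N → Σcomp w N ≡ Σ< N (λ i → c (suc i) * Σcomp w₁ (N ∸ suc i) + d (suc i) * Σcomp w₂ (N ∸ suc i))
Σcomp-rec w w₁ w₂ c d w[]≡0 w-cons zero = trans (+-identityʳ (w [])) w[]≡0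
Σcomp-rec w w₁ w₂ c d w[]≡0 w-cons (suc m) =
  trans (Σcomp-suc w m) (Σ<-cong (suc m) (λ i _ → linear (suc i) (compositions (m ∸ i))))
  where
  linear : ∀ p (xs : List (List ℕ)) →
    sum (map (w ∘ (p ∷_)) xs) ≡ c p * sum (map w₁ xs) + d p * sum (map w₂ xs)
  linear p xs = begin
    sum (map (w ∘ (p ∷_)) xs)                                   ≡⟨ cong sum (map-cong (w-cons p) xs) ⟩
    sum (map (λ ps → c p * w₁ ps + d p * w₂ ps) xs)             ≡⟨ sum-map-+ _ _ xs ⟩
    sum (map (λ ps → c p * w₁ ps) xs) + sum (map (λ ps → d p * w₂ ps) xs)
      ≡⟨ cong₂ _+_ (sum-map-* (c p) w₁ xs) (sum-map-* (d p) w₂ xs) ⟩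
    c p * sum (map w₁ xs) + d p * sum (map w₂ xs)               ∎
    where open ≡-Reasoning

%-cong-+ : ∀ k .{{_ : NonZero k}} a b c → a % k ≡ b % k → (a + c) % k ≡ (b + c) % k
%-cong-+ k a b c e =
  trans (%-distribˡ-+ a c k) (trans (cong (λ x → (x + c % k) % k) e) (sym (%-distribˡ-+ b c k)))

-- Subtracting the same number s ≤ k preserves congruence mod k (add k ∸ s instead).
%-cancel-+ : ∀ k .{{_ : NonZero k}} a b s → s ≤ k → (a + s) % k ≡ (b + s) % k → a % k ≡ b % k
%-cancel-+ k a b s s≤k e = begin
  a % k                   ≡⟨ sym ([m+n]%n≡m%n a k) ⟩
  (a + k) % k             ≡⟨ cong (_% k) (complete a) ⟩
  (a + s + (k ∸ s)) % k   ≡⟨ %-cong-+ k (a + s) (b + s) (k ∸ s) e ⟩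
  (b + s + (k ∸ s)) % k   ≡⟨ cong (_% k) (sym (complete b)) ⟩
  (b + k) % k             ≡⟨ [m+n]%n≡m%n b k ⟩
  b % k                   ∎
  where
  open ≡-Reasoning
  complete : ∀ x → x + k ≡ x + s + (k ∸ s)
  complete x = trans (cong (x +_) (sym (m+[n∸m]≡n s≤k))) (sym (+-assoc x s (k ∸ s)))

%-injective-range : ∀ k .{{_ : NonZero k}} {x m} → 1 ≤ x → x < m → m ≤ k → x % k ≢ m % k
%-injective-range k {x} {m} 1≤x x<m m≤k e with m≤n⇒m<n∨m≡n m≤k
... | inj₁ m<k = <⇒≢ x<m (trans (sym (m<n⇒m%n≡m (<-≤-trans x<m m≤k))) (trans e (m<n⇒m%n≡m m<k)))
... | inj₂ refl = <⇒≱ 1≤x (≤-reflexive (trans (sym (m<n⇒m%n≡m x<m)) (trans e (n%n≡0 k))))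

module Recurrences (k r s : ℕ) {{_ : NonZero k}} (distinct : r % k ≢ (r + s) % k) where

  r? : Decidable (λ p → p % k ≡ r % k)
  r? p = p % k ≟ r % k
  rs? : Decidable (λ p → p % k ≡ (r + s) % k)
  rs? p = p % k ≟ (r + s) % k

  f g : ℕ → ℕ
  f p = indicator (r? p)
  g p = indicator (rs? p)

  #r #rs : List ℕ → ℕ
  #r ps = length (partsCong k r ps)
  #rs ps = length (partsCong k (r + s) ps)

  allR partsAllR oneRS : List ℕ → ℕ
  allR ps = indicator (allCong? k r ps)
  partsAllR ps = allR ps * length ps
  oneRS ps = indicator (oneSpecial? k r s ps)

  A T B : ℕ → ℕ
  A = Σcomp allR
  T = Σcomp partsAllR
  B = Σcomp oneRS

  disjoint : ∀ {p} → p % k ≡ r % k → p % k ≢ (r + s) % k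
  disjoint a b = distinct (trans (sym a) b)

  -- Since no part is counted twice, #rs ps + #r ps ≤ length ps.
  #rs+#r≤length : ∀ ps → #rs ps + #r ps ≤ length ps
  #rs+#r≤length [] = z≤n
  #rs+#r≤length (p ∷ ps) with p % k ≟ (r + s) % k | p % k ≟ r % k
  ... | yes b | yes a = ⊥-elim (disjoint a b)
  ... | yes b | no a
    rewrite filter-accept rs? {p} {ps} b
          | filter-reject r? {p} {ps} a = s≤s (#rs+#r≤length ps)
  ... | no b | yes a
    rewrite filter-reject rs? {p} {ps} b
          | filter-accept r? {p} {ps} a | +-suc (#rs ps) (#r ps) = s≤s (#rs+#r≤length ps)
  ... | no b | no a
    rewrite filter-reject rs? {p} {ps} b
          | filter-reject r? {p} {ps} a = m≤n⇒m≤1+n (#rs+#r≤length ps)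

  allR⇔full : ∀ ps → AllCong k r ps ⇔ (#r ps ≡ length ps)
  allR⇔full ps = mk⇔
    (λ all → cong length (filter-all r? all))
    (λ full → subst (AllCong k r) (filter-complete r? full) (all-filter r? ps))

  allR⇒no-rs : ∀ {ps} → AllCong k r ps → #rs ps ≡ 0
  allR⇒no-rs all = cong length (filter-none rs? (All.map disjoint all))

  oneSpecial-cons-r : ∀ {p} ps → p % k ≡ r % k → OneSpecial k r s (p ∷ ps) ⇔ OneSpecial k r s ps
  oneSpecial-cons-r {p} ps a
    rewrite filter-reject rs? {p} {ps} (disjoint a)
          | filter-accept r? {p} {ps} a | +-suc (#rs ps) (#r ps)
    = mk⇔ (map₂ suc-injective) (map₂ (cong suc))

  oneSpecial-cons-rs : ∀ {p} ps → p % k ≡ (r + s) % k → OneSpecial k r s (p ∷ ps) ⇔ AllCong k r ps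
  oneSpecial-cons-rs {p} ps b
    rewrite filter-accept rs? {p} {ps} b
          | filter-reject r? {p} {ps} (λ a → disjoint a b)
    = mk⇔ to from
    where
    to : suc (#rs ps) ≡ 1 × suc (#rs ps + #r ps) ≡ suc (length ps) → AllCong k r ps
    to (one , total) = Equivalence.from (allR⇔full ps)
      (trans (cong (_+ #r ps) (sym (suc-injective one))) (suc-injective total))
    from : AllCong k r ps → suc (#rs ps) ≡ 1 × suc (#rs ps + #r ps) ≡ suc (length ps)
    from all = cong suc (allR⇒no-rs all) ,
      cong suc (cong₂ _+_ (allR⇒no-rs all) (Equivalence.to (allR⇔full ps) all))

  -- Prepending a part of any other residue leaves too few counted parts.
  oneSpecial-cons-other : ∀ {p} ps → p % k ≢ r % k → p % k ≢ (r + s) % k → ¬ OneSpecial k r s (p ∷ ps)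
  oneSpecial-cons-other {p} ps ¬a ¬b
    rewrite filter-reject rs? {p} {ps} ¬b
          | filter-reject r? {p} {ps} ¬a
    = λ (_ , total) → 1+n≰n (subst (_≤ length ps) total (#rs+#r≤length ps))

  allR-cons : ∀ p ps → allR (p ∷ ps) ≡ f p * allR ps
  allR-cons p ps = trans
    (indicator-⇔ (mk⇔ (λ { (a ∷ as) → a , as }) (λ (a , as) → a ∷ as))
      (allCong? k r (p ∷ ps)) (r? p ×-dec allCong? k r ps))
    (indicator-× (r? p) (allCong? k r ps))

  -- The first part contributes one part to every composition counted by A.
  partsAllR-cons : ∀ p ps → partsAllR (p ∷ ps) ≡ f p * partsAllR ps + f p * allR ps
  partsAllR-cons p ps = begin
    allR (p ∷ ps) * suc (length ps)         ≡⟨ cong (_* suc (length ps)) (allR-cons p ps) ⟩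
    f p * allR ps * suc (length ps)         ≡⟨ *-assoc (f p) (allR ps) (suc (length ps)) ⟩
    f p * (allR ps * suc (length ps))       ≡⟨ cong (f p *_) (*-suc (allR ps) (length ps)) ⟩
    f p * (allR ps + partsAllR ps)          ≡⟨ cong (f p *_) (+-comm (allR ps) (partsAllR ps)) ⟩
    f p * (partsAllR ps + allR ps)          ≡⟨ *-distribˡ-+ (f p) (partsAllR ps) (allR ps) ⟩
    f p * partsAllR ps + f p * allR ps      ∎
    where open ≡-Reasoning

  -- The special part is either the first part (then the rest is counted by A) or not (then the first part is ≡ r).
  oneRS-cons : ∀ p ps → oneRS (p ∷ ps) ≡ f p * oneRS ps + g p * allR ps
  oneRS-cons p ps with r? p | rs? p
  ... | yes a | yes b = ⊥-elim (disjoint a b)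
  ... | yes a | no _ = trans (indicator-⇔ (oneSpecial-cons-r ps a) _ _)
    (sym (trans (+-identityʳ (oneRS ps + 0)) (+-identityʳ (oneRS ps))))
  ... | no _ | yes b = trans (indicator-⇔ (oneSpecial-cons-rs ps b) _ _)
    (sym (+-identityʳ (allR ps)))
  ... | no ¬a | no ¬b = indicator-¬ (oneSpecial-cons-other ps ¬a ¬b) _

  T-rec : ∀ N → T N ≡ Σ< N (λ i → f (suc i) * T (N ∸ suc i) + f (suc i) * A (N ∸ suc i))
  T-rec = Σcomp-rec partsAllR partsAllR allR f f refl partsAllR-cons

  B-rec : ∀ N → B N ≡ Σ< N (λ i → f (suc i) * B (N ∸ suc i) + g (suc i) * A (N ∸ suc i))
  B-rec = Σcomp-rec oneRS oneRS allR f g refl oneRS-cons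

module Identity (k r s : ℕ) {{_ : NonZero k}} (1≤r : 1 ≤ r) (1≤s : 1 ≤ s) (r+s≤k : r + s ≤ k) where

  open Recurrences k r s (%-injective-range k 1≤r (m<m+n r 1≤s) r+s≤k) public

  -- No part 1 … s is ≡ r + s, since s < r + s ≤ k.
  g-small : ∀ i → i < s → g (suc i) ≡ 0
  g-small i i<s = indicator-¬ (%-injective-range k (s≤s z≤n) (≤-<-trans i<s (m<n+m s 1≤r)) r+s≤k) _

  g-shift : ∀ p → g (p + s) ≡ f p
  g-shift p = indicator-⇔ (mk⇔ (%-cancel-+ k p r s s≤k) (%-cong-+ k p r s)) _ _
    where
    s≤k : s ≤ k
    s≤k = ≤-trans (m≤n+m s r) r+s≤k

  -- A composition with a part ≡ r + s has a part larger than s, so B vanishes below s.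
  B-small : ∀ j → j < s → B j ≡ 0
  B-small = <-rec (λ j → j < s → B j ≡ 0) step
    where
    step : ∀ j → (∀ {j'} → j' < j → j' < s → B j' ≡ 0) → j < s → B j ≡ 0
    step j rec j<s = trans (B-rec j) (Σ<-zero j term)
      where
      term : ∀ i → i < j → f (suc i) * B (j ∸ suc i) + g (suc i) * A (j ∸ suc i) ≡ 0
      term i i<j = trans
        (cong₂ _+_ (cong (f (suc i) *_) (rec (∸-monoʳ-< (s≤s z≤n) i<j) (≤-<-trans (m∸n≤m j (suc i)) j<s)))
                   (cong (_* A (j ∸ suc i)) (g-small i (<-trans i<j j<s))))
        (trans (+-identityʳ _) (*-zeroʳ (f (suc i))))

  -- First half of B-rec at n + s: by induction the first part is ≡ r with rest counted
  -- by B (m + s) = T m for m < n; for longer first parts the rest is below s.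
  ordinary-first : ∀ n → (∀ {m} → m < n → B (m + s) ≡ T m) →
    Σ< (n + s) (λ i → f (suc i) * B (n + s ∸ suc i)) ≡ Σ< n (λ i → f (suc i) * T (n ∸ suc i))
  ordinary-first n rec = trans (Σ<-split n s _) (trans (cong₂ _+_ head tail) (+-identityʳ _))
    where
    head : Σ< n (λ i → f (suc i) * B (n + s ∸ suc i)) ≡ Σ< n (λ i → f (suc i) * T (n ∸ suc i))
    head = Σ<-cong n (λ i i<n → cong (f (suc i) *_)
      (trans (cong B (+-∸-comm s i<n)) (rec (∸-monoʳ-< (s≤s z≤n) i<n))))
    tail-index : ∀ j → n + s ∸ suc (n + j) ≡ s ∸ suc j
    tail-index j = trans (cong (n + s ∸_) (sym (+-suc n j))) ([m+n]∸[m+o]≡n∸o n s (suc j))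
    tail : Σ< s (λ j → f (suc (n + j)) * B (n + s ∸ suc (n + j))) ≡ 0
    tail = Σ<-zero s (λ j j<s → trans
      (cong (f (suc (n + j)) *_) (trans (cong B (tail-index j)) (B-small (s ∸ suc j) (∸-monoʳ-< (s≤s z≤n) j<s))))
      (*-zeroʳ (f (suc (n + j)))))

  -- Second half of B-rec at n + s: the special first part is s + p with p ≡ r, and the rest is counted by A.
  special-first : ∀ n →
    Σ< (n + s) (λ i → g (suc i) * A (n + s ∸ suc i)) ≡ Σ< n (λ i → f (suc i) * A (n ∸ suc i))
  special-first n = begin
    Σ< (n + s) G                          ≡⟨ cong (λ N → Σ< N G) (+-comm n s) ⟩
    Σ< (s + n) G                          ≡⟨ Σ<-split s n G ⟩
    Σ< s G + Σ< n (λ j → G (s + j))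
      ≡⟨ cong₂ _+_ (Σ<-zero s (λ j j<s → cong (_* A (n + s ∸ suc j)) (g-small j j<s)))
                   (Σ<-cong n (λ j _ → shifted j)) ⟩
    Σ< n (λ j → f (suc j) * A (n ∸ suc j)) ∎
    where
    open ≡-Reasoning
    G : ℕ → ℕ
    G i = g (suc i) * A (n + s ∸ suc i)
    shifted : ∀ j → G (s + j) ≡ f (suc j) * A (n ∸ suc j)
    shifted j = cong₂ _*_
      (trans (cong (g ∘ suc) (+-comm s j)) (g-shift (suc j)))
      (cong A (trans (cong₂ _∸_ (+-comm n s) (sym (+-suc s j))) ([m+n]∸[m+o]≡n∸o s n (suc j))))

  -- The main identity, by strong induction on n: the two halves of B-rec at n + s
  -- recombine into T-rec at n.
  B-shift : ∀ n → B (n + s) ≡ T n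
  B-shift = <-rec (λ n → B (n + s) ≡ T n) step
    where
    step : ∀ n → (∀ {m} → m < n → B (m + s) ≡ T m) → B (n + s) ≡ T n
    step n rec = begin
      B (n + s)                                          ≡⟨ B-rec (n + s) ⟩
      Σ< (n + s) (λ i → FB i + GA i)                     ≡⟨ Σ<-+ (n + s) FB GA ⟩
      Σ< (n + s) FB + Σ< (n + s) GA                      ≡⟨ cong₂ _+_ (ordinary-first n rec) (special-first n) ⟩
      Σ< n FT + Σ< n FA                                  ≡⟨ sym (Σ<-+ n FT FA) ⟩
      Σ< n (λ i → FT i + FA i)                           ≡⟨ sym (T-rec n) ⟩
      T n                                                ∎
      where
      open ≡-Reasoning
      FB GA FT FA : ℕ → ℕ
      FB i = f (suc i) * B (n + s ∸ suc i)
      GA i = g (suc i) * A (n + s ∸ suc i)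
      FT i = f (suc i) * T (n ∸ suc i)
      FA i = f (suc i) * A (n ∸ suc i)

proposition6p1 : (k r s n : ℕ) → (k≥2 : 2 ≤ k) → 1 ≤ r → r ≤ k ∸ 1 → 1 ≤ s → s ≤ k ∸ r →
    length (filter (oneSpecial? k r s {{>-nonZero (<-≤-trans (s≤s z≤n) k≥2)}}) (compositions (n + s)))
      ≡ sum (map length (filter (allCong? k r {{>-nonZero (<-≤-trans (s≤s z≤n) k≥2)}}) (compositions n)))
proposition6p1 k r s n k≥2 1≤r r≤k∸1 1≤s s≤k∸r = begin
  length (filter (oneSpecial? k r s) (compositions (n + s)))
    ≡⟨ length-filter-indicator (oneSpecial? k r s) (compositions (n + s)) ⟩
  B (n + s)
    ≡⟨ B-shift n ⟩
  T n
    ≡⟨ sym (sum-map-filter (allCong? k r) length (compositions n)) ⟩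
  sum (map length (filter (allCong? k r) (compositions n)))
    ∎
  where
  open ≡-Reasoning
  instance
    k≢0 : NonZero k
    k≢0 = >-nonZero (<-≤-trans (s≤s z≤n) k≥2)
  r+s≤k : r + s ≤ k
  r+s≤k = ≤-trans (+-monoʳ-≤ r s≤k∸r) (≤-reflexive (m+[n∸m]≡n (≤-trans r≤k∸1 (m∸n≤m k 1))))
  open Identity k r s 1≤r 1≤s r+s≤k
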